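{- Let $F=(F_1,\ldots,F_n)\in\mathbb{Z}[X_1,\ldots,X_n]^n$ be a polynomial map of the form $F_i=X_i+H_i$, where each $H_i$ has lower degree $\ge 2$, and let $D=\max_i\deg H_i$. Let $P_0(X)=X$, $P_{k+1}=P_k\circ F-P_k$. Then for every $k=1,2,\ldots$ we have \[ l(P_{k+1})\le \big(l(F)-1\big)\cdot\prod_{j=1}^{k}\big[l(F)^{D^j}+1\big].\]
   Context: The lower degree of a polynomial is the minimal total degree of a monomial appearing in it with nonzero coefficient. For a polynomial $T$, its length $l(T)$ is the number of monomials appearing in $T$ (with nonzero coefficient); for a polynomial map $T=(T_1,\ldots,T_n)$, $l(T)=\max\{l(T_1),\ldots,l(T_n)\}$. -}

module Defs where

open import Data.Nat as ℕ using (ℕ; zero; suc; _⊔_; _^_)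
open import Data.Integer as ℤ using (ℤ; 0ℤ; 1ℤ)
open import Data.Integer.Properties as ℤP using ()
open import Data.Fin as Fin using (Fin)
open import Data.Fin.Properties using () renaming (_≟_ to _≟F_)
open import Data.Vec as Vec using (Vec)
open import Data.Vec.Properties using (≡-dec)
open import Data.List as List using (List; []; _∷_; _++_)
open import Data.Product using (_×_; _,_; proj₂)
open import Relation.Nullary using (¬_; ¬?; yes; no)
open import Relation.Binary.PropositionalEquality using (_≡_)

-- Exponent vectors of monomials in X_1..X_n.
Mono : ℕ → Set
Mono n = Vec ℕ n

_≟M_ : ∀ {n} (e f : Mono n) → Relation.Nullary.Dec (e ≡ f)
_≟M_ = ≡-dec ℕ._≟_

totalDeg : ∀ {n} → Mono n → ℕ
totalDeg = Vec.sum

-- A polynomial in ℤ[X_1..X_n] given as a formal (unnormalised) sum of terms c·X^e.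
-- All notions below (coefficients, length, degrees) are semantic, i.e. independent
-- of the representation.
Poly : ℕ → Set
Poly n = List (ℤ × Mono n)

coeff : ∀ {n} → Poly n → Mono n → ℤ
coeff [] m = 0ℤ
coeff ((c , e) ∷ p) m with e ≟M m
... | yes _ = c ℤ.+ coeff p m
... | no  _ = coeff p m

support : ∀ {n} → Poly n → List (Mono n)
support p = List.deduplicate _≟M_
  (List.filter (λ m → ¬? (coeff p m ℤ.≟ 0ℤ)) (List.map proj₂ p))

len : ∀ {n} → Poly n → ℕ
len p = List.length (support p)

-- total degree (the zero polynomial is given degree 0)
deg : ∀ {n} → Poly n → ℕ
deg p = List.foldr _⊔_ 0 (List.map totalDeg (support p))

LowerDegGe2 : ∀ {n} → Poly n → Set
LowerDegGe2 p = ∀ m → ¬ (coeff p m ≡ 0ℤ) → 2 ℕ.≤ totalDeg m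

neg : ∀ {n} → Poly n → Poly n
neg = List.map (λ { (c , e) → (ℤ.- c , e) })

add : ∀ {n} → Poly n → Poly n → Poly n
add = _++_

sub : ∀ {n} → Poly n → Poly n → Poly n
sub p q = p ++ neg q

mul : ∀ {n} → Poly n → Poly n → Poly n
mul p q = List.concatMap
  (λ { (c , e) → List.map (λ { (d , f) → (c ℤ.* d , Vec.zipWith ℕ._+_ e f) }) q }) p

one : ∀ {n} → Poly n
one = (1ℤ , Vec.replicate _ 0) ∷ []

pow : ∀ {n} → Poly n → ℕ → Poly n
pow p zero = one
pow p (suc k) = mul p (pow p k)

scale : ∀ {n} → ℤ → Poly n → Poly n
scale c = List.map (λ { (d , f) → (c ℤ.* d , f) })

var : ∀ {n} → Fin n → Poly n
var {n} i = (1ℤ , Vec.tabulate (λ j → δ j)) ∷ []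
  where
  δ : Fin n → ℕ
  δ j with i ≟F j
  ... | yes _ = 1
  ... | no  _ = 0

PolyMap : ℕ → Set
PolyMap n = Fin n → Poly n

evalMono : ∀ {n} → PolyMap n → Mono n → Poly n
evalMono {n} G e =
  List.foldr mul one (List.map (λ i → pow (G i) (Vec.lookup e i)) (List.allFin n))

compose : ∀ {n} → Poly n → PolyMap n → Poly n
compose p G = List.concatMap (λ { (c , e) → scale c (evalMono G e) }) p

composeMap : ∀ {n} → PolyMap n → PolyMap n → PolyMap n
composeMap T G i = compose (T i) G

lenMap : ∀ {n} → PolyMap n → ℕ
lenMap {n} T = List.foldr _⊔_ 0 (List.map (λ i → len (T i)) (List.allFin n))

degMap : ∀ {n} → PolyMap n → ℕ
degMap {n} T = List.foldr _⊔_ 0 (List.map (λ i → deg (T i)) (List.allFin n))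

idMap : ∀ {n} → PolyMap n
idMap = var

Pseq : ∀ {n} → PolyMap n → ℕ → PolyMap n
Pseq F zero = idMap
Pseq F (suc k) i = sub (composeMap (Pseq F k) F i) (Pseq F k i)

prodFrom1 : (ℕ → ℕ) → ℕ → ℕ
prodFrom1 f zero = 1
prodFrom1 f (suc k) = prodFrom1 f k ℕ.* f (suc k)

-- Write F = X + H with H of lower degree ≥ 2, L = l(F) and D = max_i deg H_i.
-- The proof carries along the recursion a bound on the number of monomials and
-- on the total degree of every component of P_{k+1}:
--   * P_1 = X ∘ F − X = H, so l(P_1) ≤ L − 1 (X_i is a monomial of F_i but not
--     of H_i) and every monomial of P_1 has degree ≤ D;
--   * if every monomial of p has degree ≤ δ, then under composition a monomial
--     X^e of p becomes ∏_j F_j^{e_j}, whose monomials lie in an explicit list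
--     of at most L^{|e|} ≤ L^δ candidates, each of degree ≤ δ·max(D,1).  Hence
--     l(p ∘ F − p) ≤ l(p)·(L^δ + 1), and all degrees stay ≤ δ·max(D,1).
-- With δ = D^k at step k this gives the product bound.

module Submission where

open import Defs
open import Data.Nat using (ℕ; suc; _≤_; _*_; _+_; _∸_; _^_)
open import Data.Fin using (Fin)
open import Data.Nat using (zero; z≤n; s≤s; _⊔_; NonZero; >-nonZero)
import Data.Nat.Properties as ℕP
open import Data.Nat.ListAction using (sum)
open import Data.Integer using (ℤ; 0ℤ; 1ℤ)
  renaming (_+_ to _+ℤ_; _*_ to _*ℤ_; -_ to -ℤ_; _≟_ to _≟ℤ_)
import Data.Integer.Properties as ℤP
import Data.Fin as Fin
open import Data.Fin.Properties using (suc-injective) renaming (_≟_ to _≟F_)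
open import Data.Vec as Vec using (Vec; []; _∷_)
import Data.Vec.Properties as VecP
open import Data.List as List using (List; []; _∷_; _++_)
import Data.List.Properties as ListP
open import Data.List.Membership.Propositional using (_∈_; _∉_; find; lose)
open import Data.List.Membership.Propositional.Properties
  using (∈-map⁺; ∈-++⁺ˡ; ∈-++⁺ʳ; ∈-filter⁺; ∈-filter⁻; ∈-deduplicate⁺; ∈-deduplicate⁻;
         ∈-concatMap⁺; ∈-concatMap⁻; ∈-allFin)
open import Data.List.Relation.Unary.Any using (here; there; index; _─_)
open import Data.List.Relation.Unary.All as All using (All; []; _∷_)
import Data.List.Relation.Unary.All.Properties as AllP
open import Data.List.Relation.Unary.AllPairs using ([]; _∷_)
open import Data.List.Relation.Unary.Unique.Propositional using (Unique)
import Data.List.Relation.Unary.Unique.Propositional.Properties as UniqueP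
import Data.List.Relation.Unary.Unique.DecPropositional.Properties as UniqueDecP
open import Data.Product using (∃; _×_; _,_; proj₁; proj₂)
open import Data.Sum using (_⊎_; inj₁; inj₂)
open import Data.Empty using (⊥-elim)
open import Function using (_∘_; _∋_)
open import Relation.Nullary using (¬_; ¬?; Dec; yes; no)
open import Relation.Binary.PropositionalEquality
open import Algebra.Properties.CommutativeSemigroup ℕP.+-commutativeSemigroup
  using () renaming (interchange to +-interchange)
open import Algebra.Properties.CommutativeSemigroup ℤP.+-commutativeSemigroup
  using () renaming (interchange to +ℤ-interchange)
open import Algebra.Properties.AbelianGroup ℤP.+-0-abelianGroup
  using () renaming (xyx⁻¹≈y to +ℤ-cancel)

private variable n : ℕ

0ᴹ : Mono n
0ᴹ = Vec.replicate _ 0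

infixl 21 _+ᴹ_
_+ᴹ_ : Mono n → Mono n → Mono n
_+ᴹ_ = Vec.zipWith _+_

+ᴹ-identityˡ : (f : Mono n) → 0ᴹ +ᴹ f ≡ f
+ᴹ-identityˡ []      = refl
+ᴹ-identityˡ (x ∷ f) = cong (x ∷_) (+ᴹ-identityˡ f)

+ᴹ-identityʳ : (e : Mono n) → e +ᴹ 0ᴹ ≡ e
+ᴹ-identityʳ []      = refl
+ᴹ-identityʳ (x ∷ e) = cong₂ _∷_ (ℕP.+-identityʳ x) (+ᴹ-identityʳ e)

-- Monomial multiplication is cancellative; this makes X^e · q a faithful copy of q.
+ᴹ-cancelˡ : (e : Mono n) {f f′ : Mono n} → e +ᴹ f ≡ e +ᴹ f′ → f ≡ f′
+ᴹ-cancelˡ []      {[]}    {[]}      _  = refl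
+ᴹ-cancelˡ (x ∷ e) {y ∷ f} {y′ ∷ f′} eq =
  cong₂ _∷_ (ℕP.+-cancelˡ-≡ x y y′ (VecP.∷-injectiveˡ eq)) (+ᴹ-cancelˡ e (VecP.∷-injectiveʳ eq))

cofactor-+ᴹ : (e f : Mono n) → Vec.zipWith _∸_ (e +ᴹ f) e ≡ f
cofactor-+ᴹ []      []      = refl
cofactor-+ᴹ (x ∷ e) (y ∷ f) = cong₂ _∷_ (ℕP.m+n∸m≡n x y) (cofactor-+ᴹ e f)

-- Divisibility of monomials is decidable: the only possible cofactor is m ∸ e.
divides? : (e m : Mono n) → Dec (∃ λ f → e +ᴹ f ≡ m)
divides? e m with e +ᴹ Vec.zipWith _∸_ m e ≟M m
... | yes eq = yes (_ , eq)
... | no neq = no λ (f , e+f≡m) →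
  neq (subst (λ z → e +ᴹ Vec.zipWith _∸_ z e ≡ z) e+f≡m (cong (e +ᴹ_) (cofactor-+ᴹ e f)))

totalDeg-0ᴹ : (n : ℕ) → totalDeg (0ᴹ {n}) ≡ 0
totalDeg-0ᴹ zero    = refl
totalDeg-0ᴹ (suc n) = totalDeg-0ᴹ n

totalDeg-+ᴹ : (e f : Mono n) → totalDeg (e +ᴹ f) ≡ totalDeg e + totalDeg f
totalDeg-+ᴹ []      []      = refl
totalDeg-+ᴹ (x ∷ e) (y ∷ f) =
  trans (cong (x + y +_) (totalDeg-+ᴹ e f)) (+-interchange x y (totalDeg e) (totalDeg f))

-- |e| as the sum of the exponents over all variables, the form in which it
-- arises from the definition of substitution (evalMono).
sum-lookup-allFin : (e : Mono n) → sum (List.map (Vec.lookup e) (List.allFin n)) ≡ totalDeg e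
sum-lookup-allFin []      = refl
sum-lookup-allFin (x ∷ e) = cong (x +_) (begin
  sum (List.map (Vec.lookup (x ∷ e)) (List.tabulate Fin.suc))
    ≡⟨ cong sum (ListP.map-tabulate Fin.suc (Vec.lookup (x ∷ e))) ⟩
  sum (List.tabulate (Vec.lookup e))
    ≡⟨ cong sum (ListP.map-tabulate (λ i → i) (Vec.lookup e)) ⟨
  sum (List.map (Vec.lookup e) (List.allFin _))
    ≡⟨ sum-lookup-allFin e ⟩
  totalDeg e ∎)
  where open ≡-Reasoning

record _≈_ {n : ℕ} (p q : Poly n) : Set where
  constructor coeffs-≡
  field coeff-≡ : ∀ m → coeff p m ≡ coeff q m
open _≈_

≈-trans : {p q r : Poly n} → p ≈ q → q ≈ r → p ≈ r
≈-trans p≈q q≈r = coeffs-≡ λ m → trans (coeff-≡ p≈q m) (coeff-≡ q≈r m)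

termCoeff : ℤ → Mono n → Mono n → ℤ
termCoeff c e m with e ≟M m
... | yes _ = c
... | no  _ = 0ℤ

termCoeff-≡ : (c : ℤ) (e : Mono n) → termCoeff c e e ≡ c
termCoeff-≡ c e with e ≟M e
... | yes _  = refl
... | no e≢e = ⊥-elim (e≢e refl)

termCoeff-≢ : (c : ℤ) {e m : Mono n} → e ≢ m → termCoeff c e m ≡ 0ℤ
termCoeff-≢ c {e} {m} e≢m with e ≟M m
... | yes e≡m = ⊥-elim (e≢m e≡m)
... | no  _   = refl

*-termCoeff : (c : ℤ) (e m : Mono n) → c *ℤ termCoeff 1ℤ e m ≡ termCoeff c e m
*-termCoeff c e m with e ≟M m
... | yes _ = ℤP.*-identityʳ c
... | no  _ = ℤP.*-zeroʳ c

coeff-∷ : (c : ℤ) (e : Mono n) (p : Poly n) (m : Mono n) →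
          coeff ((c , e) ∷ p) m ≡ termCoeff c e m +ℤ coeff p m
coeff-∷ c e p m with e ≟M m
... | yes _ = refl
... | no  _ = sym (ℤP.+-identityˡ _)

coeff-++ : (p q : Poly n) (m : Mono n) → coeff (p ++ q) m ≡ coeff p m +ℤ coeff q m
coeff-++ []            q m = sym (ℤP.+-identityˡ _)
coeff-++ ((c , e) ∷ p) q m with e ≟M m
... | yes _ = trans (cong (c +ℤ_) (coeff-++ p q m)) (sym (ℤP.+-assoc c _ _))
... | no  _ = coeff-++ p q m

coeff-neg : (p : Poly n) (m : Mono n) → coeff (neg p) m ≡ -ℤ coeff p m
coeff-neg []            m = refl
coeff-neg ((c , e) ∷ p) m with e ≟M m
... | yes _ = trans (cong (-ℤ c +ℤ_) (coeff-neg p m)) (sym (ℤP.neg-distrib-+ c _))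
... | no  _ = coeff-neg p m

coeff-scale : (d : ℤ) (p : Poly n) (m : Mono n) → coeff (scale d p) m ≡ d *ℤ coeff p m
coeff-scale d []            m = sym (ℤP.*-zeroʳ d)
coeff-scale d ((c , e) ∷ p) m with e ≟M m
... | yes _ = trans (cong (d *ℤ c +ℤ_) (coeff-scale d p m)) (sym (ℤP.*-distribˡ-+ d c _))
... | no  _ = coeff-scale d p m

-- Σterms p g = Σ c·g(e) over the terms c·X^e of the representation of p.
-- Coefficients of products and of compositions are sums of this shape.
Σterms : Poly n → (Mono n → ℤ) → ℤ
Σterms []            g = 0ℤ
Σterms ((c , e) ∷ p) g = c *ℤ g e +ℤ Σterms p g

Σterms-cong : (p : Poly n) {g h : Mono n → ℤ} → (∀ e → g e ≡ h e) → Σterms p g ≡ Σterms p h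
Σterms-cong []            g≡h = refl
Σterms-cong ((c , e) ∷ p) g≡h = cong₂ _+ℤ_ (cong (c *ℤ_) (g≡h e)) (Σterms-cong p g≡h)

Σterms-termCoeff : (p : Poly n) (m : Mono n) → Σterms p (λ e → termCoeff 1ℤ e m) ≡ coeff p m
Σterms-termCoeff []            m = refl
Σterms-termCoeff ((c , e) ∷ p) m =
  trans (cong₂ _+ℤ_ (*-termCoeff c e m) (Σterms-termCoeff p m)) (sym (coeff-∷ c e p m))

shift : Mono n → Poly n → Poly n
shift e = List.map (λ (d , f) → (d , e +ᴹ f))

coeff-shift : (e : Mono n) (q : Poly n) (f : Mono n) → coeff (shift e q) (e +ᴹ f) ≡ coeff q f
coeff-shift e []             f = refl
coeff-shift e ((d , f′) ∷ q) f with e +ᴹ f′ ≟M e +ᴹ f | f′ ≟M f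
... | yes _  | yes _    = cong (d +ℤ_) (coeff-shift e q f)
... | yes eq | no f′≢f  = ⊥-elim (f′≢f (+ᴹ-cancelˡ e eq))
... | no neq | yes refl = ⊥-elim (neq refl)
... | no _   | no _     = coeff-shift e q f

coeff-shift-∤ : (e : Mono n) (q : Poly n) {m : Mono n} →
                ¬ (∃ λ f → e +ᴹ f ≡ m) → coeff (shift e q) m ≡ 0ℤ
coeff-shift-∤ e []            e∤m = refl
coeff-shift-∤ e ((d , f) ∷ q) {m} e∤m with e +ᴹ f ≟M m
... | yes eq = ⊥-elim (e∤m (f , eq))
... | no  _  = coeff-shift-∤ e q e∤m

mul-∷ : (c : ℤ) (e : Mono n) (p q : Poly n) → mul ((c , e) ∷ p) q ≡ scale c (shift e q) ++ mul p q
mul-∷ c e p q = cong (_++ mul p q) (ListP.map-∘ q)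

coeff-mul : (p q : Poly n) (m : Mono n) → coeff (mul p q) m ≡ Σterms p (λ e → coeff (shift e q) m)
coeff-mul []            q m = refl
coeff-mul ((c , e) ∷ p) q m = begin
  coeff (mul ((c , e) ∷ p) q) m                        ≡⟨ cong (λ r → coeff r m) (mul-∷ c e p q) ⟩
  coeff (scale c (shift e q) ++ mul p q) m             ≡⟨ coeff-++ (scale c (shift e q)) (mul p q) m ⟩
  coeff (scale c (shift e q)) m +ℤ coeff (mul p q) m   ≡⟨ cong₂ _+ℤ_ (coeff-scale c (shift e q) m)
                                                                     (coeff-mul p q m) ⟩
  c *ℤ coeff (shift e q) m +ℤ Σterms p (λ e → coeff (shift e q) m) ∎
  where open ≡-Reasoning

coeff-compose : (p : Poly n) (G : PolyMap n) (m : Mono n) →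
                coeff (compose p G) m ≡ Σterms p (λ e → coeff (evalMono G e) m)
coeff-compose []            G m = refl
coeff-compose ((c , e) ∷ p) G m =
  trans (coeff-++ (scale c (evalMono G e)) (compose p G) m)
        (cong₂ _+ℤ_ (coeff-scale c (evalMono G e) m) (coeff-compose p G m))

sumOver : List (Mono n) → (Mono n → ℤ) → ℤ
sumOver []      h = 0ℤ
sumOver (u ∷ U) h = h u +ℤ sumOver U h

sumOver-cong : (U : List (Mono n)) {g h : Mono n → ℤ} → (∀ u → g u ≡ h u) →
               sumOver U g ≡ sumOver U h
sumOver-cong []      g≡h = refl
sumOver-cong (u ∷ U) g≡h = cong₂ _+ℤ_ (g≡h u) (sumOver-cong U g≡h)

sumOver-+ : (U : List (Mono n)) (g h : Mono n → ℤ) →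
            sumOver U (λ u → g u +ℤ h u) ≡ sumOver U g +ℤ sumOver U h
sumOver-+ []      g h = refl
sumOver-+ (u ∷ U) g h =
  trans (cong (g u +ℤ h u +ℤ_) (sumOver-+ U g h)) (+ℤ-interchange (g u) (h u) _ _)

sumOver-0 : (U : List (Mono n)) {h : Mono n → ℤ} → (∀ u → h u ≡ 0ℤ) → sumOver U h ≡ 0ℤ
sumOver-0 []      h≡0 = refl
sumOver-0 (u ∷ U) h≡0 = trans (cong₂ _+ℤ_ (h≡0 u) (sumOver-0 U h≡0)) refl

sumOver-nonzero : (U : List (Mono n)) (h : Mono n → ℤ) → sumOver U h ≢ 0ℤ →
                  ∃ λ u → u ∈ U × h u ≢ 0ℤ
sumOver-nonzero []      h Σ≢0 = ⊥-elim (Σ≢0 refl)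
sumOver-nonzero (u ∷ U) h Σ≢0 with h u ≟ℤ 0ℤ
... | no  hu≢0 = u , here refl , hu≢0
... | yes hu≡0 =
  let v , v∈U , hv≢0 = sumOver-nonzero U h (λ ΣU≡0 → Σ≢0 (cong₂ _+ℤ_ hu≡0 ΣU≡0))
  in  v , there v∈U , hv≢0

sumOver-∉ : (U : List (Mono n)) (c : ℤ) (e : Mono n) (g : Mono n → ℤ) →
            e ∉ U → sumOver U (λ u → termCoeff c e u *ℤ g u) ≡ 0ℤ
sumOver-∉ []      c e g e∉U = refl
sumOver-∉ (u ∷ U) c e g e∉U =
  trans (cong₂ _+ℤ_ (cong (_*ℤ g u) (termCoeff-≢ c (e∉U ∘ here))) (sumOver-∉ U c e g (e∉U ∘ there)))
        refl

sumOver-∈ : (U : List (Mono n)) (c : ℤ) (e : Mono n) (g : Mono n → ℤ) →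
            Unique U → e ∈ U → sumOver U (λ u → termCoeff c e u *ℤ g u) ≡ c *ℤ g e
sumOver-∈ (u ∷ U) c e g (u∉U ∷ _) (here refl) =
  trans (cong₂ _+ℤ_ (cong (_*ℤ g e) (termCoeff-≡ c e))
                    (sumOver-∉ U c e g (λ e∈U → All.lookup u∉U e∈U refl)))
        (ℤP.+-identityʳ _)
sumOver-∈ (u ∷ U) c e g (u∉U ∷ U!) (there e∈U) =
  trans (cong₂ _+ℤ_ (cong (_*ℤ g u) (termCoeff-≢ c {e} {u} (λ e≡u → All.lookup u∉U e∈U (sym e≡u))))
                    (sumOver-∈ U c e g U! e∈U))
        (ℤP.+-identityˡ _)

exponents : Poly n → List (Mono n)
exponents = List.map proj₂

collect : (p : Poly n) (U : List (Mono n)) (g : Mono n → ℤ) → Unique U →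
          (∀ {e} → e ∈ exponents p → e ∈ U) → Σterms p g ≡ sumOver U (λ u → coeff p u *ℤ g u)
collect [] U g U! ⊆U = sym (sumOver-0 U (λ u → ℤP.*-zeroˡ (g u)))
collect ((c , e) ∷ p) U g U! ⊆U = sym (begin
  sumOver U (λ u → coeff ((c , e) ∷ p) u *ℤ g u)
    ≡⟨ sumOver-cong U (λ u → trans (cong (_*ℤ g u) (coeff-∷ c e p u))
                                   (ℤP.*-distribʳ-+ (g u) (termCoeff c e u) (coeff p u))) ⟩
  sumOver U (λ u → termCoeff c e u *ℤ g u +ℤ coeff p u *ℤ g u)
    ≡⟨ sumOver-+ U _ _ ⟩
  sumOver U (λ u → termCoeff c e u *ℤ g u) +ℤ sumOver U (λ u → coeff p u *ℤ g u)
    ≡⟨ cong₂ _+ℤ_ (sumOver-∈ U c e g U! (⊆U (here refl))) (sym (collect p U g U! (⊆U ∘ there))) ⟩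
  c *ℤ g e +ℤ Σterms p g ∎)
  where open ≡-Reasoning

Σterms-nonzero : (p : Poly n) (g : Mono n → ℤ) → Σterms p g ≢ 0ℤ →
                 ∃ λ e → coeff p e ≢ 0ℤ × g e ≢ 0ℤ
Σterms-nonzero p g Σ≢0 =
  let U  = List.deduplicate _≟M_ (exponents p)
      e , _ , ce≢0 = sumOver-nonzero U (λ u → coeff p u *ℤ g u)
        (Σ≢0 ∘ trans (collect p U g (UniqueDecP.deduplicate-! _≟M_ _) (∈-deduplicate⁺ _≟M_)))
  in  e , (λ pe≡0 → ce≢0 (cong (_*ℤ g e) pe≡0))
        , (λ ge≡0 → ce≢0 (trans (cong (coeff p e *ℤ_) ge≡0) (ℤP.*-zeroʳ (coeff p e))))

coeff-shift-cong : (e : Mono n) {q q′ : Poly n} (m : Mono n) → q ≈ q′ →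
                   coeff (shift e q) m ≡ coeff (shift e q′) m
coeff-shift-cong e {q} {q′} m q≈q′ with divides? e m
... | yes (f , refl) = trans (coeff-shift e q f) (trans (coeff-≡ q≈q′ f) (sym (coeff-shift e q′ f)))
... | no  e∤m        = trans (coeff-shift-∤ e q e∤m) (sym (coeff-shift-∤ e q′ e∤m))

mul-congʳ : (p : Poly n) {q q′ : Poly n} → q ≈ q′ → mul p q ≈ mul p q′
mul-congʳ p {q} {q′} q≈q′ = coeffs-≡ λ m →
  trans (coeff-mul p q m)
        (trans (Σterms-cong p (λ e → coeff-shift-cong e {q} {q′} m q≈q′)) (sym (coeff-mul p q′ m)))

mul-identityˡ : (p : Poly n) → mul one p ≈ p
mul-identityˡ p = coeffs-≡ λ m → begin
  coeff (mul one p) m                  ≡⟨ coeff-mul one p m ⟩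
  1ℤ *ℤ coeff (shift 0ᴹ p) m +ℤ 0ℤ     ≡⟨ ℤP.+-identityʳ _ ⟩
  1ℤ *ℤ coeff (shift 0ᴹ p) m           ≡⟨ ℤP.*-identityˡ _ ⟩
  coeff (shift 0ᴹ p) m                 ≡⟨ subst (λ z → coeff (shift 0ᴹ p) z ≡ coeff p m)
                                                (+ᴹ-identityˡ m) (coeff-shift 0ᴹ p m) ⟩
  coeff p m                            ∎
  where open ≡-Reasoning

coeff-shift-one : (e m : Mono n) → coeff (shift e one) m ≡ termCoeff 1ℤ e m
coeff-shift-one e m = trans (coeff-∷ 1ℤ (e +ᴹ 0ᴹ) [] m)
  (trans (ℤP.+-identityʳ _) (cong (λ z → termCoeff 1ℤ z m) (+ᴹ-identityʳ e)))

mul-identityʳ : (p : Poly n) → mul p one ≈ p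
mul-identityʳ p = coeffs-≡ λ m → begin
  coeff (mul p one) m                            ≡⟨ coeff-mul p one m ⟩
  Σterms p (λ e → coeff (shift e one) m)         ≡⟨ Σterms-cong p (λ e → coeff-shift-one e m) ⟩
  Σterms p (λ e → termCoeff 1ℤ e m)              ≡⟨ Σterms-termCoeff p m ⟩
  coeff p m                                      ∎
  where open ≡-Reasoning

module _ {A : Set} where

  ∈-─ : (ys : List A) {x y : A} (x∈ys : x ∈ ys) → y ∈ ys → y ≢ x → y ∈ (ys ─ x∈ys)
  ∈-─ (_ ∷ ys) (here refl)  (here refl)  y≢x = ⊥-elim (y≢x refl)
  ∈-─ (_ ∷ ys) (here refl)  (there y∈ys) y≢x = y∈ys
  ∈-─ (_ ∷ ys) (there x∈ys) (here refl)  y≢x = here refl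
  ∈-─ (_ ∷ ys) (there x∈ys) (there y∈ys) y≢x = there (∈-─ ys x∈ys y∈ys y≢x)

  length-unique-⊆ : {xs : List A} (ys : List A) → Unique xs → (∀ {z} → z ∈ xs → z ∈ ys) →
                    List.length xs ≤ List.length ys
  length-unique-⊆ {[]}     ys _                xs⊆ys = z≤n
  length-unique-⊆ {x ∷ xs} ys (x∉xs ∷ xs!) xs⊆ys =
    subst (suc (List.length xs) ≤_) (sym (ListP.length-removeAt′ ys (index x∈ys)))
      (s≤s (length-unique-⊆ (ys ─ x∈ys) xs!
             (λ z∈xs → ∈-─ ys x∈ys (xs⊆ys (there z∈xs)) (λ z≡x → All.lookup x∉xs z∈xs (sym z≡x)))))
    where x∈ys = xs⊆ys (here refl)

nonzero-∈-exponents : (p : Poly n) (m : Mono n) → coeff p m ≢ 0ℤ → m ∈ exponents p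
nonzero-∈-exponents []            m pm≢0 = ⊥-elim (pm≢0 refl)
nonzero-∈-exponents ((c , e) ∷ p) m pm≢0 with e ≟M m
... | yes e≡m = here (sym e≡m)
... | no  _   = there (nonzero-∈-exponents p m pm≢0)

∈-support : (p : Poly n) {m : Mono n} → coeff p m ≢ 0ℤ → m ∈ support p
∈-support p {m} pm≢0 = ∈-deduplicate⁺ _≟M_
  (∈-filter⁺ (λ m → ¬? (coeff p m ≟ℤ 0ℤ)) (nonzero-∈-exponents p m pm≢0) pm≢0)

support-nonzero : (p : Poly n) {m : Mono n} → m ∈ support p → coeff p m ≢ 0ℤ
support-nonzero p m∈ =
  proj₂ (∈-filter⁻ (λ m → ¬? (coeff p m ≟ℤ 0ℤ)) {xs = exponents p} (∈-deduplicate⁻ _≟M_ _ m∈))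

support-unique : (p : Poly n) → Unique (support p)
support-unique p = UniqueDecP.deduplicate-! _≟M_ _

Covers : List (Mono n) → Poly n → Set
Covers S p = ∀ m → coeff p m ≢ 0ℤ → m ∈ S

len-≤-cover : (S : List (Mono n)) (p : Poly n) → Covers S p → len p ≤ List.length S
len-≤-cover S p S-covers = length-unique-⊆ S (support-unique p) (S-covers _ ∘ support-nonzero p)

length-≤-len : (U : List (Mono n)) (p : Poly n) → Unique U →
               (∀ {m} → m ∈ U → coeff p m ≢ 0ℤ) → List.length U ≤ len p
length-≤-len U p U! U-nonzero = length-unique-⊆ (support p) U! (∈-support p ∘ U-nonzero)

-- Equal polynomials have the same length (one inequality; the other by symmetry).
len-≈ : {p q : Poly n} → p ≈ q → len p ≤ len q
len-≈ {p = p} {q} p≈q =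
  len-≤-cover (support q) p (λ m pm≢0 → ∈-support q (pm≢0 ∘ trans (coeff-≡ p≈q m)))

nonzero-+ : (a b : ℤ) → a +ℤ b ≢ 0ℤ → a ≢ 0ℤ ⊎ b ≢ 0ℤ
nonzero-+ a b a+b≢0 with a ≟ℤ 0ℤ
... | no  a≢0  = inj₁ a≢0
... | yes refl = inj₂ (a+b≢0 ∘ trans (ℤP.+-identityˡ b))

Covers-++ : (S T : List (Mono n)) (p q : Poly n) → Covers S p → Covers T q → Covers (S ++ T) (p ++ q)
Covers-++ S T p q S-covers T-covers m pq≢0
  with nonzero-+ (coeff p m) (coeff q m) (pq≢0 ∘ trans (coeff-++ p q m))
... | inj₁ pm≢0 = ∈-++⁺ˡ (S-covers m pm≢0)
... | inj₂ qm≢0 = ∈-++⁺ʳ S (T-covers m qm≢0)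

Covers-neg : (S : List (Mono n)) (p : Poly n) → Covers S p → Covers S (neg p)
Covers-neg S p S-covers m -pm≢0 = S-covers m (λ pm≡0 → -pm≢0 (trans (coeff-neg p m) (cong -ℤ_ pm≡0)))

len-sub : (p q : Poly n) → len (sub p q) ≤ len p + len q
len-sub p q = begin
  len (sub p q)                                     ≤⟨ len-≤-cover _ (sub p q) covers ⟩
  List.length (support p ++ support q)              ≡⟨ ListP.length-++ (support p) ⟩
  len p + len q                                     ∎
  where
  open ℕP.≤-Reasoning
  covers : Covers (support p ++ support q) (sub p q)
  covers = Covers-++ _ _ p (neg q) (λ _ → ∈-support p)
                                   (Covers-neg (support q) q (λ _ → ∈-support q))

DegreeAtMost : ℕ → Poly n → Set
DegreeAtMost δ p = ∀ m → coeff p m ≢ 0ℤ → totalDeg m ≤ δ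

DegreesAtMost : ℕ → List (Mono n) → Set
DegreesAtMost δ = All (λ m → totalDeg m ≤ δ)

DegreeAtMost-≈ : {δ : ℕ} {p q : Poly n} → p ≈ q → DegreeAtMost δ q → DegreeAtMost δ p
DegreeAtMost-≈ p≈q deg-q m pm≢0 = deg-q m (pm≢0 ∘ trans (coeff-≡ p≈q m))

DegreeAtMost-mono : {δ δ′ : ℕ} (p : Poly n) → δ ≤ δ′ → DegreeAtMost δ p → DegreeAtMost δ′ p
DegreeAtMost-mono p δ≤δ′ deg-p m pm≢0 = ℕP.≤-trans (deg-p m pm≢0) δ≤δ′

DegreeAtMost-sub : {δ : ℕ} (p q : Poly n) → DegreeAtMost δ p → DegreeAtMost δ q →
                   DegreeAtMost δ (sub p q)
DegreeAtMost-sub p q deg-p deg-q m pq≢0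
  with nonzero-+ (coeff p m) (coeff (neg q) m) (pq≢0 ∘ trans (coeff-++ p (neg q) m))
... | inj₁ pm≢0  = deg-p m pm≢0
... | inj₂ -qm≢0 = deg-q m (λ qm≡0 → -qm≢0 (trans (coeff-neg q m) (cong -ℤ_ qm≡0)))

infixr 6 _⊗_
_⊗_ : List (Mono n) → List (Mono n) → List (Mono n)
S ⊗ T = List.concatMap (λ a → List.map (a +ᴹ_) T) S

∈-⊗ : (S T : List (Mono n)) {a b : Mono n} → a ∈ S → b ∈ T → a +ᴹ b ∈ S ⊗ T
∈-⊗ (a ∷ S) T (here refl) b∈T = ∈-++⁺ˡ (∈-map⁺ (a +ᴹ_) b∈T)
∈-⊗ (a ∷ S) T (there a∈S) b∈T = ∈-++⁺ʳ (List.map (a +ᴹ_) T) (∈-⊗ S T a∈S b∈T)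

length-⊗ : (S T : List (Mono n)) → List.length (S ⊗ T) ≡ List.length S * List.length T
length-⊗ []      T = refl
length-⊗ (a ∷ S) T = trans (ListP.length-++ (List.map (a +ᴹ_) T))
                           (cong₂ _+_ (ListP.length-map (a +ᴹ_) T) (length-⊗ S T))

degrees-⊗ : {δ δ′ : ℕ} (S T : List (Mono n)) → DegreesAtMost δ S → DegreesAtMost δ′ T →
            DegreesAtMost (δ + δ′) (S ⊗ T)
degrees-⊗ []      T []             deg-T = []
degrees-⊗ (a ∷ S) T (deg-a ∷ deg-S) deg-T =
  AllP.++⁺ (AllP.map⁺ (All.map (λ {b} deg-b → ℕP.≤-trans (ℕP.≤-reflexive (totalDeg-+ᴹ a b))
                                                         (ℕP.+-mono-≤ deg-a deg-b)) deg-T))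
           (degrees-⊗ S T deg-S deg-T)

Covers-mul : (S T : List (Mono n)) (p q : Poly n) → Covers S p → Covers T q → Covers (S ⊗ T) (mul p q)
Covers-mul S T p q S-covers T-covers m pq≢0
  with Σterms-nonzero p (λ e → coeff (shift e q) m) (pq≢0 ∘ trans (coeff-mul p q m))
... | e , pe≢0 , shift≢0 with divides? e m
...   | no  e∤m        = ⊥-elim (shift≢0 (coeff-shift-∤ e q e∤m))
...   | yes (f , refl) = ∈-⊗ S T (S-covers e pe≢0) (T-covers f (shift≢0 ∘ trans (coeff-shift e q f)))

Covers-one : Covers {n} (0ᴹ ∷ []) one
Covers-one m one≢0 with 0ᴹ ≟M m
... | yes refl = here refl
... | no  _    = ⊥-elim (one≢0 refl)

powers : List (Mono n) → ℕ → List (Mono n)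
powers S zero    = 0ᴹ ∷ []
powers S (suc k) = S ⊗ powers S k

Covers-pow : (S : List (Mono n)) (p : Poly n) (k : ℕ) → Covers S p → Covers (powers S k) (pow p k)
Covers-pow S p zero    S-covers = Covers-one
Covers-pow S p (suc k) S-covers =
  Covers-mul S (powers S k) p (pow p k) S-covers (Covers-pow S p k S-covers)

length-powers : (S : List (Mono n)) (k : ℕ) → List.length (powers S k) ≡ List.length S ^ k
length-powers S zero    = refl
length-powers S (suc k) = trans (length-⊗ S (powers S k)) (cong (List.length S *_) (length-powers S k))

degrees-powers : {δ : ℕ} (S : List (Mono n)) (k : ℕ) → DegreesAtMost δ S →
                 DegreesAtMost (k * δ) (powers S k)
degrees-powers {n} S zero    deg-S = ℕP.≤-reflexive (totalDeg-0ᴹ n) ∷ []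
degrees-powers     S (suc k) deg-S = degrees-⊗ S (powers S k) deg-S (degrees-powers S k deg-S)

-- Candidate monomials of the product ∏_{j ∈ js} G_j^{e_j} (the substitution of
-- G into X^e, when js lists all variables), given candidates S_j for each G_j.
module Products {n : ℕ} (S : Fin n → List (Mono n)) (e : Mono n) where

  factor : Fin n → List (Mono n)
  factor j = powers (S j) (Vec.lookup e j)

  productCover : List (Fin n) → List (Mono n)
  productCover js = List.foldr _⊗_ (0ᴹ ∷ []) (List.map factor js)

  weight : List (Fin n) → ℕ
  weight js = sum (List.map (Vec.lookup e) js)

  product : PolyMap n → List (Fin n) → Poly n
  product G js = List.foldr mul one (List.map (λ j → pow (G j) (Vec.lookup e j)) js)

  Covers-product : (G : PolyMap n) → (∀ j → Covers (S j) (G j)) → (js : List (Fin n)) →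
    Covers (productCover js) (product G js)
  Covers-product G S-covers []       = Covers-one
  Covers-product G S-covers (j ∷ js) =
    Covers-mul (factor j) (productCover js) (pow (G j) (Vec.lookup e j)) (product G js)
      (Covers-pow (S j) (G j) (Vec.lookup e j) (S-covers j)) (Covers-product G S-covers js)

  length-productCover : (L : ℕ) → (∀ j → List.length (S j) ≤ L) → (js : List (Fin n)) →
                        List.length (productCover js) ≤ L ^ weight js
  length-productCover L S≤L []       = ℕP.≤-refl
  length-productCover L S≤L (j ∷ js) = begin
    List.length (productCover (j ∷ js))                    ≡⟨ length-⊗ (factor j) (productCover js) ⟩
    List.length (factor j) * List.length (productCover js)
      ≡⟨ cong (_* List.length (productCover js)) (length-powers (S j) (Vec.lookup e j)) ⟩
    List.length (S j) ^ Vec.lookup e j * List.length (productCover js)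
      ≤⟨ ℕP.*-mono-≤ (ℕP.^-monoˡ-≤ (Vec.lookup e j) (S≤L j)) (length-productCover L S≤L js) ⟩
    L ^ Vec.lookup e j * L ^ weight js                     ≡⟨ ℕP.^-distribˡ-+-* L (Vec.lookup e j) _ ⟨
    L ^ weight (j ∷ js)                                    ∎
    where open ℕP.≤-Reasoning

  degrees-productCover : (d : ℕ) → (∀ j → DegreesAtMost d (S j)) → (js : List (Fin n)) →
                         DegreesAtMost (weight js * d) (productCover js)
  degrees-productCover d deg-S []       = ℕP.≤-reflexive (totalDeg-0ᴹ n) ∷ []
  degrees-productCover d deg-S (j ∷ js) =
    All.map (λ deg≤ → ℕP.≤-trans deg≤
                        (ℕP.≤-reflexive (sym (ℕP.*-distribʳ-+ d (Vec.lookup e j) (weight js)))))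
      (degrees-⊗ (factor j) (productCover js)
        (degrees-powers (S j) (Vec.lookup e j) (deg-S j)) (degrees-productCover d deg-S js))

length-concatMap-≤ : {A B : Set} (f : A → List B) (xs : List A) (b : ℕ) →
                     All (λ x → List.length (f x) ≤ b) xs →
                     List.length (List.concatMap f xs) ≤ List.length xs * b
length-concatMap-≤ f []       b []          = z≤n
length-concatMap-≤ f (x ∷ xs) b (fx≤b ∷ fxs≤b) =
  ℕP.≤-trans (ℕP.≤-reflexive (ListP.length-++ (f x)))
             (ℕP.+-mono-≤ fx≤b (length-concatMap-≤ f xs b fxs≤b))

module Composition {n : ℕ} (G : PolyMap n) (S : Fin n → List (Mono n))
                   (S-covers : ∀ j → Covers (S j) (G j)) where

  evalCover : Mono n → List (Mono n)
  evalCover e = Products.productCover S e (List.allFin n)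

  compose-cover : (p : Poly n) → Covers (List.concatMap evalCover (support p)) (compose p G)
  compose-cover p m pG≢0 =
    let e , pe≢0 , eG≢0 = Σterms-nonzero p (λ e → coeff (evalMono G e) m)
                                           (pG≢0 ∘ trans (coeff-compose p G m))
    in  ∈-concatMap⁺ evalCover (lose (∈-support p pe≢0)
                           (Products.Covers-product S e G S-covers (List.allFin n) m eG≢0))

  weight-≤ : (δ : ℕ) (p : Poly n) → DegreeAtMost δ p →
             ∀ {e} → e ∈ support p → Products.weight S e (List.allFin n) ≤ δ
  weight-≤ δ p deg-p {e} e∈ =
    ℕP.≤-trans (ℕP.≤-reflexive (sum-lookup-allFin e)) (deg-p e (support-nonzero p e∈))

  len-compose : (L δ : ℕ) .{{_ : NonZero L}} → (∀ j → List.length (S j) ≤ L) →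
                (p : Poly n) → DegreeAtMost δ p → len (compose p G) ≤ len p * L ^ δ
  len-compose L δ S≤L p deg-p = begin
    len (compose p G)
      ≤⟨ len-≤-cover _ (compose p G) (compose-cover p) ⟩
    List.length (List.concatMap evalCover (support p))
      ≤⟨ length-concatMap-≤ evalCover (support p) (L ^ δ) (All.tabulate evalCover≤) ⟩
    len p * L ^ δ ∎
    where
    open ℕP.≤-Reasoning
    evalCover≤ : ∀ {e} → e ∈ support p → List.length (evalCover e) ≤ L ^ δ
    evalCover≤ {e} e∈ = ℕP.≤-trans (Products.length-productCover S e L S≤L (List.allFin n))
                                   (ℕP.^-monoʳ-≤ L (weight-≤ δ p deg-p e∈))

  degree-compose : (d δ : ℕ) → (∀ j → DegreesAtMost d (S j)) →
                   (p : Poly n) → DegreeAtMost δ p → DegreeAtMost (δ * d) (compose p G)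
  degree-compose d δ deg-S p deg-p m pG≢0 =
    let e , e∈ , m∈ = find (∈-concatMap⁻ evalCover {xs = support p} (compose-cover p m pG≢0))
    in  ℕP.≤-trans (All.lookup (Products.degrees-productCover S e d deg-S (List.allFin n)) m∈)
                   (ℕP.*-monoˡ-≤ d (weight-≤ δ p deg-p e∈))

-- the exponent vector of X_i, read off from the definition of var
unit : Fin n → Mono n
unit i = List.foldr (λ t _ → proj₂ t) 0ᴹ (var i)

lookup-unit-≡ : (i : Fin n) → Vec.lookup (unit i) i ≡ 1
lookup-unit-≡ i with i ≟F i | (Vec.lookup (unit i) i ≡ _) ∋ VecP.lookup∘tabulate _ i
... | yes _   | eq = eq
... | no i≢i  | _  = ⊥-elim (i≢i refl)

lookup-unit-≢ : {i j : Fin n} → i ≢ j → Vec.lookup (unit i) j ≡ 0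
lookup-unit-≢ {i = i} {j} i≢j with i ≟F j | (Vec.lookup (unit i) j ≡ _) ∋ VecP.lookup∘tabulate _ j
... | yes i≡j | _  = ⊥-elim (i≢j i≡j)
... | no _    | eq = eq

sum-indicator : (v : Vec ℕ n) (i : Fin n) → Vec.lookup v i ≡ 1 →
                (∀ {j} → i ≢ j → Vec.lookup v j ≡ 0) → Vec.sum v ≡ 1
sum-indicator (x ∷ v) Fin.zero    x≡1 rest≡0 =
  cong₂ _+_ x≡1 (sum-zero v (λ j → rest≡0 {Fin.suc j} (λ ())))
  where
  sum-zero : ∀ {k} (w : Vec ℕ k) → (∀ j → Vec.lookup w j ≡ 0) → Vec.sum w ≡ 0
  sum-zero []      w≡0 = refl
  sum-zero (y ∷ w) w≡0 = cong₂ _+_ (w≡0 Fin.zero) (sum-zero w (w≡0 ∘ Fin.suc))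
sum-indicator (x ∷ v) (Fin.suc i) vi≡1 rest≡0 =
  cong₂ _+_ (rest≡0 {Fin.zero} (λ ()))
            (sum-indicator v i vi≡1 (λ {j} i≢j → rest≡0 {Fin.suc j} (i≢j ∘ suc-injective)))

totalDeg-unit : (i : Fin n) → totalDeg (unit i) ≡ 1
totalDeg-unit i = sum-indicator (unit i) i (lookup-unit-≡ i) lookup-unit-≢

coeff-var : (i : Fin n) (m : Mono n) → coeff (var i) m ≡ termCoeff 1ℤ (unit i) m
coeff-var i m = trans (coeff-∷ 1ℤ (unit i) [] m) (ℤP.+-identityʳ _)

-- Substituting G into X_i: the factors G_j^{0} = 1 (j ≠ i) drop out.
module Substitution {n : ℕ} (G : PolyMap n) (i : Fin n) where

  partialProduct : List (Fin n) → Poly n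
  partialProduct js = List.foldr mul one (List.map (λ j → pow (G j) (Vec.lookup (unit i) j)) js)

  partialProduct-∉ : (js : List (Fin n)) → i ∉ js → partialProduct js ≈ one
  partialProduct-∉ []       i∉js = coeffs-≡ λ _ → refl
  partialProduct-∉ (j ∷ js) i∉js rewrite lookup-unit-≢ (i∉js ∘ here) =
    ≈-trans (mul-identityˡ (partialProduct js)) (partialProduct-∉ js (i∉js ∘ there))

  partialProduct-∈ : (js : List (Fin n)) → Unique js → i ∈ js → partialProduct js ≈ G i
  partialProduct-∈ (j ∷ js) (j∉js ∷ js!) (here refl) rewrite lookup-unit-≡ i =
    ≈-trans (mul-congʳ (mul (G i) one) (partialProduct-∉ js (λ i∈js → All.lookup j∉js i∈js refl)))
            (≈-trans (mul-identityʳ (mul (G i) one)) (mul-identityʳ (G i)))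
  partialProduct-∈ (j ∷ js) (j∉js ∷ js!) (there i∈js)
    rewrite lookup-unit-≢ (λ i≡j → All.lookup j∉js i∈js (sym i≡j)) =
    ≈-trans (mul-identityˡ (partialProduct js)) (partialProduct-∈ js js! i∈js)

  evalMono-unit : evalMono G (unit i) ≈ G i
  evalMono-unit = partialProduct-∈ (List.allFin n) (UniqueP.allFin⁺ n) (∈-allFin i)

compose-var : (G : PolyMap n) (i : Fin n) → compose (var i) G ≈ G i
compose-var G i = coeffs-≡ λ m →
  trans (coeff-compose (var i) G m)
        (trans (ℤP.+-identityʳ _)
               (trans (ℤP.*-identityˡ _) (coeff-≡ (Substitution.evalMono-unit G i) m)))

foldr-⊔-upper : {x : ℕ} (xs : List ℕ) → x ∈ xs → x ≤ List.foldr _⊔_ 0 xs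
foldr-⊔-upper (y ∷ xs) (here refl) = ℕP.m≤m⊔n y _
foldr-⊔-upper (y ∷ xs) (there x∈) = ℕP.≤-trans (foldr-⊔-upper xs x∈) (ℕP.m≤n⊔m y _)

foldr-⊔-least : {b : ℕ} (xs : List ℕ) → All (_≤ b) xs → List.foldr _⊔_ 0 xs ≤ b
foldr-⊔-least []       []           = z≤n
foldr-⊔-least (y ∷ xs) (y≤b ∷ xs≤b) = ℕP.⊔-lub y≤b (foldr-⊔-least xs xs≤b)

len≤lenMap : (T : PolyMap n) (i : Fin n) → len (T i) ≤ lenMap T
len≤lenMap T i = foldr-⊔-upper _ (∈-map⁺ (λ i → len (T i)) (∈-allFin i))

lenMap-least : (T : PolyMap n) (b : ℕ) → (∀ i → len (T i) ≤ b) → lenMap T ≤ b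
lenMap-least {n} T b T≤b =
  foldr-⊔-least _ (AllP.map⁺ (All.tabulate {xs = List.allFin n} (λ {i} _ → T≤b i)))

degree-≤-degMap : (T : PolyMap n) (i : Fin n) → DegreeAtMost (degMap T) (T i)
degree-≤-degMap T i m Tim≢0 =
  ℕP.≤-trans (foldr-⊔-upper _ (∈-map⁺ totalDeg (∈-support (T i) Tim≢0)))
             (foldr-⊔-upper _ (∈-map⁺ (λ i → deg (T i)) (∈-allFin i)))

-- D^{k+1}·max(D,1) = D^{k+2}, also when D = 0
^-suc-*-⊔1 : (D k : ℕ) → D ^ suc k * (D ⊔ 1) ≡ D ^ suc (suc k)
^-suc-*-⊔1 zero    k = refl
^-suc-*-⊔1 (suc d) k = trans (cong (suc d ^ suc k *_) (cong suc (ℕP.⊔-identityʳ d)))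
                             (ℕP.*-comm (suc d ^ suc k) (suc d))

module IteratedDifferences {n : ℕ} (H : PolyMap n) (H-low : ∀ i → LowerDegGe2 (H i)) where

  F : PolyMap n
  F i = add (var i) (H i)

  L D : ℕ
  L = lenMap F
  D = degMap H

  -- H_i has no monomial of degree 1, in particular not X_i.
  coeff-H-unit : (i : Fin n) → coeff (H i) (unit i) ≡ 0ℤ
  coeff-H-unit i with coeff (H i) (unit i) ≟ℤ 0ℤ
  ... | yes Hi≡0 = Hi≡0
  ... | no  Hi≢0 = ⊥-elim (ℕP.<-irrefl refl (subst (2 ≤_) (totalDeg-unit i) (H-low i (unit i) Hi≢0)))

  degree-H : (i : Fin n) → DegreeAtMost D (H i)
  degree-H = degree-≤-degMap H

  coeff-F : (i : Fin n) (m : Mono n) → coeff (F i) m ≡ termCoeff 1ℤ (unit i) m +ℤ coeff (H i) m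
  coeff-F i m = trans (coeff-++ (var i) (H i) m) (cong (_+ℤ coeff (H i) m) (coeff-var i m))

  coeff-F-unit : (i : Fin n) → coeff (F i) (unit i) ≡ 1ℤ
  coeff-F-unit i = trans (coeff-F i (unit i))
    (trans (cong₂ _+ℤ_ (termCoeff-≡ 1ℤ (unit i)) (coeff-H-unit i)) (ℤP.+-identityʳ 1ℤ))

  monomialsF : Fin n → List (Mono n)
  monomialsF i = unit i ∷ support (H i)

  monomialsF-covers : (i : Fin n) → Covers (monomialsF i) (F i)
  monomialsF-covers i m Fim≢0 = by-cases (unit i ≟M m)
    where
    by-cases : Dec (unit i ≡ m) → m ∈ monomialsF i
    by-cases (yes refl) = here refl
    by-cases (no  i≢m)  = there (∈-support (H i) (λ Him≡0 → Fim≢0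
                            (trans (coeff-F i m) (cong₂ _+ℤ_ (termCoeff-≢ 1ℤ i≢m) Him≡0))))

  unit∉H : (i : Fin n) {m : Mono n} → m ∈ support (H i) → unit i ≢ m
  unit∉H i m∈ refl = support-nonzero (H i) m∈ (coeff-H-unit i)

  monomialsF-nonzero : (i : Fin n) {m : Mono n} → m ∈ monomialsF i → coeff (F i) m ≢ 0ℤ
  monomialsF-nonzero i (here refl) Fi≡0 with trans (sym (coeff-F-unit i)) Fi≡0
  ... | ()
  monomialsF-nonzero i {m} (there m∈) Fim≡0 = support-nonzero (H i) m∈ (begin
    coeff (H i) m                                  ≡⟨ ℤP.+-identityˡ _ ⟨
    0ℤ +ℤ coeff (H i) m                            ≡⟨ cong (_+ℤ coeff (H i) m) (termCoeff-≢ 1ℤ (unit∉H i m∈)) ⟨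
    termCoeff 1ℤ (unit i) m +ℤ coeff (H i) m       ≡⟨ coeff-F i m ⟨
    coeff (F i) m                                  ≡⟨ Fim≡0 ⟩
    0ℤ                                             ∎)
    where open ≡-Reasoning

  length-monomialsF : (i : Fin n) → List.length (monomialsF i) ≤ L
  length-monomialsF i = ℕP.≤-trans
    (length-≤-len (monomialsF i) (F i) (All.tabulate (unit∉H i) ∷ support-unique (H i))
                  (monomialsF-nonzero i))
    (len≤lenMap F i)

  len-H : (i : Fin n) → len (H i) ≤ L ∸ 1
  len-H i = ℕP.∸-monoˡ-≤ 1 (length-monomialsF i)

  degrees-monomialsF : (i : Fin n) → DegreesAtMost (D ⊔ 1) (monomialsF i)
  degrees-monomialsF i = ℕP.≤-trans (ℕP.≤-reflexive (totalDeg-unit i)) (ℕP.m≤n⊔m D 1)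
    ∷ All.tabulate (λ {m} m∈ → ℕP.≤-trans (degree-H i m (support-nonzero (H i) m∈)) (ℕP.m≤m⊔n D 1))

  open Composition F monomialsF monomialsF-covers

  P₁≈H : (i : Fin n) → Pseq F 1 i ≈ H i
  P₁≈H i = coeffs-≡ λ m → begin
    coeff (sub (compose (var i) F) (var i)) m
      ≡⟨ coeff-++ (compose (var i) F) _ m ⟩
    coeff (compose (var i) F) m +ℤ coeff (neg (var i)) m
      ≡⟨ cong₂ _+ℤ_ (coeff-≡ (compose-var F i) m) (coeff-neg (var i) m) ⟩
    coeff (F i) m +ℤ -ℤ coeff (var i) m
      ≡⟨ cong (_+ℤ -ℤ coeff (var i) m) (coeff-++ (var i) (H i) m) ⟩
    coeff (var i) m +ℤ coeff (H i) m +ℤ -ℤ coeff (var i) m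
      ≡⟨ +ℤ-cancel (coeff (var i) m) (coeff (H i) m) ⟩
    coeff (H i) m ∎
    where open ≡-Reasoning

  bound : ℕ → ℕ
  bound k = (L ∸ 1) * prodFrom1 (λ j → L ^ (D ^ j) + 1) k

  Invariant : ℕ → Set
  Invariant k = ∀ i → len (Pseq F (suc k) i) ≤ bound k × DegreeAtMost (D ^ suc k) (Pseq F (suc k) i)

  invariant-base : Invariant 0
  invariant-base i =
      ℕP.≤-trans (len-≈ (P₁≈H i))
                 (ℕP.≤-trans (len-H i) (ℕP.≤-reflexive (sym (ℕP.*-identityʳ (L ∸ 1)))))
    , DegreeAtMost-mono (Pseq F 1 i) (ℕP.≤-reflexive (sym (ℕP.*-identityʳ D)))
                        (DegreeAtMost-≈ (P₁≈H i) (degree-H i))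

  invariant-step : .{{_ : NonZero L}} → (k : ℕ) → Invariant k → Invariant (suc k)
  invariant-step k inv i = len-step , degree-step
    where
    p = Pseq F (suc k) i
    δ = D ^ suc k
    len-p = proj₁ (inv i)
    deg-p = proj₂ (inv i)

    len-step : len (sub (compose p F) p) ≤ bound (suc k)
    len-step = begin
      len (sub (compose p F) p)          ≤⟨ len-sub (compose p F) p ⟩
      len (compose p F) + len p          ≤⟨ ℕP.+-monoˡ-≤ (len p) (len-compose L δ length-monomialsF p deg-p) ⟩
      len p * L ^ δ + len p              ≤⟨ ℕP.+-mono-≤ (ℕP.*-monoˡ-≤ (L ^ δ) len-p) len-p ⟩
      bound k * L ^ δ + bound k          ≡⟨ cong (bound k * L ^ δ +_) (ℕP.*-identityʳ (bound k)) ⟨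
      bound k * L ^ δ + bound k * 1      ≡⟨ ℕP.*-distribˡ-+ (bound k) (L ^ δ) 1 ⟨
      bound k * (L ^ δ + 1)              ≡⟨ ℕP.*-assoc (L ∸ 1) _ _ ⟩
      bound (suc k)                      ∎
      where open ℕP.≤-Reasoning

    degree-step : DegreeAtMost (D ^ suc (suc k)) (sub (compose p F) p)
    degree-step = subst (λ b → DegreeAtMost b (sub (compose p F) p)) (^-suc-*-⊔1 D k)
      (DegreeAtMost-sub (compose p F) p (degree-compose (D ⊔ 1) δ degrees-monomialsF p deg-p)
        (DegreeAtMost-mono p (ℕP.m≤m*n δ (D ⊔ 1) {{>-nonZero (ℕP.m≤n⊔m D 1)}}) deg-p))

  invariant : .{{_ : NonZero L}} → (k : ℕ) → Invariant k
  invariant zero    = invariant-base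
  invariant (suc k) = invariant-step k (invariant k)

  -- In positive dimension L ≥ l(F_i) ≥ 1, and the bound holds for every k.
  lenMap-bound : Fin n → (k : ℕ) → lenMap (Pseq F (suc k)) ≤ bound k
  lenMap-bound i k = lenMap-least (Pseq F (suc k)) (bound k) (proj₁ ∘ invariant {{L≢0}} k)
    where
    L≢0 : NonZero L
    L≢0 = >-nonZero (ℕP.≤-trans (s≤s z≤n) (length-monomialsF i))

corollary4p1 : (n : ℕ) (H : PolyMap n) → (∀ i → LowerDegGe2 (H i)) →
    (k : ℕ) → 1 ≤ k →
    lenMap (Pseq (λ i → add (var i) (H i)) (suc k))
      ≤ (lenMap (λ i → add (var i) (H i)) ∸ 1)
        * prodFrom1 (λ j → lenMap (λ i → add (var i) (H i)) ^ (degMap H ^ j) + 1) k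
corollary4p1 zero    H H-low k _ = z≤n
corollary4p1 (suc n) H H-low k _ = IteratedDifferences.lenMap-bound H H-low Fin.zero k
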